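{- Let $D$ be a tournament, $T\subseteq V(D)$ and $k\in\mathbb{N}$. Then $D$ has a $T$-feedback arc set of size at most $k$ if and only if there exists an order $\sigma$ of $V(D)$ with $\mathrm{cost}(\sigma)\le k$.
   Context: A $T$-cycle is a directed cycle containing a vertex of $T$; a $T$-feedback arc set is an arc set $S$ such that $D-S$ has no $T$-cycle. For an order $\sigma=(v_1,\dots,v_n)$ of $V(D)$, an arc $v_iv_j$ is backward if $j<i$; its span is $\{v_m: j\le m\le i\}$, and the arc is said to be above every vertex in its span. A backward arc above at least one terminal (vertex of $T$) is called affected. $\mathrm{cost}(\sigma)$ is the number of affected arcs w.r.t. $\sigma$. -}

module Defs where

open import Data.Bool using (Bool; true; false; not; _∧_; _∨_; if_then_else_)
open import Data.Nat using (ℕ; zero; suc; _+_; _≤_)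
open import Data.Fin using (Fin) renaming (_≤?_ to _≤F?_; _<?_ to _<F?_)
open import Data.Fin.Subset using (Subset; _∈_)
open import Data.Fin.Permutation using (Permutation′; _⟨$⟩ˡ_)
open import Data.List using (List; []; _∷_; length; map; allFin)
open import Data.Bool.ListAction using (any)
open import Data.Nat.ListAction using (sum)
open import Data.List.Relation.Unary.Any using (Any)
open import Data.List.Relation.Unary.Unique.Propositional using (Unique)
open import Data.Product using (_×_; Σ; ∃)
open import Relation.Binary.PropositionalEquality using (_≡_; _≢_)
open import Relation.Nullary.Decidable using (⌊_⌋)
open import Data.Vec using (lookup)

Digraph : ℕ → Set
Digraph n = Fin n → Fin n → Bool

IsTournament : ∀ {n} → Digraph n → Set
IsTournament {n} A =
  ((u : Fin n) → A u u ≡ false) ×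
  ((u v : Fin n) → u ≢ v → A u v ≡ not (A v u))

countPairs : ∀ {n} → (Fin n → Fin n → Bool) → ℕ
countPairs {n} f =
  sum (map (λ u → sum (map (λ v → if f u v then 1 else 0) (allFin n))) (allFin n))

Chain : ∀ {n} → Digraph n → Fin n → List (Fin n) → Fin n → Set
Chain A x [] y = A x y ≡ true
Chain A x (z ∷ zs) y = (A x z ≡ true) × Chain A z zs y

IsCycle : ∀ {n} → Digraph n → Fin n → List (Fin n) → Set
IsCycle A v vs = Unique (v ∷ vs) × (1 ≤ length vs) × Chain A v vs v

IsTCycle : ∀ {n} → Digraph n → Subset n → Fin n → List (Fin n) → Set
IsTCycle {n} A T v vs = IsCycle A v vs × Any (λ x → x ∈ T) (v ∷ vs)

removeArcs : ∀ {n} → Digraph n → (Fin n → Fin n → Bool) → Digraph n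
removeArcs A S u v = A u v ∧ not (S u v)

IsTFAS : ∀ {n} → Digraph n → Subset n → (Fin n → Fin n → Bool) → Set
IsTFAS {n} A T S =
  ((u v : Fin n) → S u v ≡ true → A u v ≡ true) ×
  ((v : Fin n) (vs : List (Fin n)) → IsTCycle (removeArcs A S) T v vs → ⊥′)
  where open import Data.Empty renaming (⊥ to ⊥′)

-- An order σ = (v_1,...,v_n) of V(D): a permutation, position i ↦ vertex v_i.
-- pos σ v is the position of v.
pos : ∀ {n} → Permutation′ n → Fin n → Fin n
pos σ v = σ ⟨$⟩ˡ v

affected : ∀ {n} → Digraph n → Subset n → Permutation′ n → Fin n → Fin n → Bool
affected {n} A T σ u v =
  A u v ∧ ⌊ pos σ v <F? pos σ u ⌋ ∧
  any (λ t → lookup T t ∧ ⌊ pos σ v ≤F? pos σ t ⌋ ∧ ⌊ pos σ t ≤F? pos σ u ⌋) (allFin n)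

cost : ∀ {n} → Digraph n → Subset n → Permutation′ n → ℕ
cost A T σ = countPairs (affected A T σ)

{-# OPTIONS --safe #-}

-- If S is a T-feedback arc set, list the vertices by nondecreasing level, where the level of v is
-- twice the number of vertices that reach v in D − S, plus one unless v is a terminal. For a
-- backward arc uv of D − S, level v ≤ level u forces v to reach u (otherwise v would have more
-- ancestors than u); so u and v lie on a cycle, hence are non-terminals of the same odd level, and
-- every vertex between them shares that level and is no terminal. Thus all affected arcs lie in S.
-- Conversely, a closed walk through a terminal t contains an arc stepping backward across the
-- position of t; that arc is affected, so the affected arcs of any order form a T-feedback arc set.
module Submission where

open import Defs
open import Data.Bool using (Bool; true; false; T; _∧_; if_then_else_)
open import Data.Bool.Properties using (T-≡; T-∧; ¬-not)
open import Data.Empty using (⊥; ⊥-elim)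
open import Data.Fin as Fin using (Fin; toℕ; fromℕ<; punchOut; _≟_)
open import Data.Fin.Properties
  using (any?; toℕ<n; toℕ-injective; toℕ-fromℕ<; fromℕ<-injective; injective⇒≤; punchOut-injective)
open import Data.Fin.Permutation using (Permutation′; permutation; _⟨$⟩ʳ_; inverseʳ)
open import Data.Fin.Subset as Subset using (Subset)
open import Data.List using (List; []; _∷_; _++_; length; map; allFin; lookup)
open import Data.List.Properties using (length-tabulate)
open import Data.List.Membership.Propositional using (_∈_; _∉_; find; lose)
open import Data.List.Membership.Propositional.Properties using (∈-allFin; ∈-lookup)
open import Data.List.Relation.Unary.Any using (here; there; satisfied)
open import Data.List.Relation.Unary.Any.Properties using (any⁺; any⁻)
open import Data.List.Relation.Unary.All using ([])
import Data.List.Relation.Unary.All as All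
open import Data.List.Relation.Unary.All.Properties using (¬Any⇒All¬)
open import Data.List.Relation.Unary.AllPairs using ([]; _∷_)
open import Data.List.Relation.Unary.Unique.Propositional using (Unique)
open import Data.Nat using (ℕ; zero; suc; _+_; _*_; _≤_; _<_; z≤n; s≤s; _≤?_; _<?_)
open import Data.Nat.ListAction using (sum)
open import Data.Nat.Properties hiding (_≟_)
open import Data.Product using (_×_; Σ; ∃; ∃₂; _,_; proj₁; proj₂)
open import Data.Unit using (tt)
open import Data.Vec using () renaming (lookup to _‼_)
open import Data.Vec.Properties using (lookup⇒[]=; []=⇒lookup)
open import Function using (_∘_; _⇔_; mk⇔; Injective; Equivalence)
open import Relation.Binary.Construct.Closure.ReflexiveTransitive using (Star; ε; _◅_; _◅◅_)
open import Relation.Binary.Definitions using (tri<; tri≈; tri>)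
open import Relation.Binary.PropositionalEquality
open import Relation.Nullary using (¬_; yes; no; Dec; contradiction)
open import Relation.Nullary.Decidable using (⌊_⌋; True; toWitness; fromWitness; map′; _×-dec_)

private
  variable
    n : ℕ

countTrue : {A : Set} → (A → Bool) → List A → ℕ
countTrue p xs = sum (map (λ x → if p x then 1 else 0) xs)

module _ {A : Set} where

  sum-map-mono-≤ : {f g : A → ℕ} → (∀ x → f x ≤ g x) → ∀ xs → sum (map f xs) ≤ sum (map g xs)
  sum-map-mono-≤ f≤g []       = z≤n
  sum-map-mono-≤ f≤g (x ∷ xs) = +-mono-≤ (f≤g x) (sum-map-mono-≤ f≤g xs)

  sum-map-mono-< : {f g : A → ℕ} → (∀ x → f x ≤ g x) → ∀ {x xs} → x ∈ xs → f x < g x →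
                   sum (map f xs) < sum (map g xs)
  sum-map-mono-< f≤g (here {xs = xs} refl) fx<gx = +-mono-<-≤ fx<gx (sum-map-mono-≤ f≤g xs)
  sum-map-mono-< f≤g (there {x = y} x∈xs)  fx<gx = +-mono-≤-< (f≤g y) (sum-map-mono-< f≤g x∈xs fx<gx)

  private
    indicator-mono-≤ : {a b : Bool} → (T a → T b) → (if a then 1 else 0) ≤ (if b then 1 else 0)
    indicator-mono-≤ {false}         _   = z≤n
    indicator-mono-≤ {true}  {true}  _   = ≤-refl
    indicator-mono-≤ {true}  {false} a⇒b = ⊥-elim (a⇒b tt)

    indicator-mono-< : {a b : Bool} → ¬ T a → T b → (if a then 1 else 0) < (if b then 1 else 0)
    indicator-mono-< {false} {true} _ _ = ≤-refl
    indicator-mono-< {true}         ¬a _ = ⊥-elim (¬a tt)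

  module _ {p q : A → Bool} (p⇒q : ∀ {x} → T (p x) → T (q x)) where

    countTrue-mono-≤ : ∀ xs → countTrue p xs ≤ countTrue q xs
    countTrue-mono-≤ = sum-map-mono-≤ (λ x → indicator-mono-≤ (p⇒q {x}))

    countTrue-mono-< : ∀ {x xs} → x ∈ xs → ¬ T (p x) → T (q x) → countTrue p xs < countTrue q xs
    countTrue-mono-< x∈xs ¬px qx =
      sum-map-mono-< (λ x → indicator-mono-≤ (p⇒q {x})) x∈xs (indicator-mono-< ¬px qx)

  countTrue<length : {p : A → Bool} → ∀ {x xs} → x ∈ xs → ¬ T (p x) → countTrue p xs < length xs
  countTrue<length {p} {xs = xs} x∈xs ¬px =
    subst (countTrue p xs <_) (countTrue-true xs) (countTrue-mono-< (λ _ → tt) x∈xs ¬px tt)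
    where
    countTrue-true : ∀ ys → countTrue (λ _ → true) ys ≡ length ys
    countTrue-true []       = refl
    countTrue-true (_ ∷ ys) = cong suc (countTrue-true ys)

countPairs-mono : {f g : Fin n → Fin n → Bool} → (∀ u v → f u v ≡ true → g u v ≡ true) →
                  countPairs f ≤ countPairs g
countPairs-mono {n} f⇒g = sum-map-mono-≤
  (λ u → countTrue-mono-≤ (λ {v} → Equivalence.from T-≡ ∘ f⇒g u v ∘ Equivalence.to T-≡) (allFin n))
  (allFin n)

length-allFin : ∀ n → length (allFin n) ≡ n
length-allFin n = length-tabulate {n = n} (λ i → i)

unique⇒length≤ : {xs : List (Fin n)} → Unique xs → length xs ≤ n
unique⇒length≤ unique = injective⇒≤ (lookup-injective unique)
  where
  lookup-injective : ∀ {xs : List (Fin n)} → Unique xs → Injective _≡_ _≡_ (lookup xs)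
  lookup-injective (_ ∷ _) {Fin.zero} {Fin.zero} _ = refl
  lookup-injective (x∉xs ∷ _) {Fin.zero} {Fin.suc j} eq = contradiction eq (All.lookup x∉xs (∈-lookup j))
  lookup-injective (x∉xs ∷ _) {Fin.suc i} {Fin.zero} eq = contradiction (sym eq) (All.lookup x∉xs (∈-lookup i))
  lookup-injective (_ ∷ unique) {Fin.suc i} {Fin.suc j} eq = cong Fin.suc (lookup-injective unique eq)

injective⇒surjective : {f : Fin n → Fin n} → Injective _≡_ _≡_ f → ∀ i → ∃ λ j → f j ≡ i
injective⇒surjective {suc m} {f} f-injective i with any? (λ j → f j ≟ i)
... | yes hit  = hit
... | no  miss = contradiction (injective⇒≤ punchOut∘f-injective) 1+n≰n
  where
  i≢f : ∀ j → i ≢ f j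
  i≢f j i≡fj = miss (j , sym i≡fj)

  punchOut∘f-injective : Injective _≡_ _≡_ (λ j → punchOut (i≢f j))
  punchOut∘f-injective {j} {k} = f-injective ∘ punchOut-injective (i≢f j) (i≢f k)

fromInjection : (f : Fin n → Fin n) → Injective _≡_ _≡_ f → Permutation′ n
fromInjection f f-injective =
  permutation f⁻¹ f (λ j → f-injective (proj₂ (surjective (f j)))) (proj₂ ∘ surjective)
  where
  surjective : ∀ i → ∃ λ j → f j ≡ i
  surjective = injective⇒surjective f-injective

  f⁻¹ : Fin _ → Fin _
  f⁻¹ = proj₁ ∘ surjective

index : Permutation′ n → Fin n → ℕ
index σ v = toℕ (pos σ v)

index-injective : (σ : Permutation′ n) → Injective _≡_ _≡_ (index σ)
index-injective σ {u} {v} eq = begin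
  u                   ≡⟨ inverseʳ σ ⟨
  σ ⟨$⟩ʳ pos σ u      ≡⟨ cong (σ ⟨$⟩ʳ_) (toℕ-injective eq) ⟩
  σ ⟨$⟩ʳ pos σ v      ≡⟨ inverseʳ σ ⟩
  v                   ∎
  where open ≡-Reasoning

module _ (K : Fin n → ℕ) where

  rank : Fin n → ℕ
  rank v = countTrue (λ w → ⌊ K w <? K v ⌋) (allFin n)

  rank<n : ∀ v → rank v < n
  rank<n v = subst (rank v <_) (length-allFin n) (countTrue<length (∈-allFin v) (<-irrefl refl ∘ toWitness))

  rank-mono-< : ∀ {u v} → K u < K v → rank u < rank v
  rank-mono-< {u} Ku<Kv = countTrue-mono-<
    (λ Kw<Ku → fromWitness (<-trans (toWitness Kw<Ku) Ku<Kv))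
    (∈-allFin u) (<-irrefl refl ∘ toWitness) (fromWitness Ku<Kv)

  module _ (K-injective : Injective _≡_ _≡_ K) where

    rank-injective : Injective _≡_ _≡_ rank
    rank-injective {u} {v} eq with <-cmp (K u) (K v)
    ... | tri< Ku<Kv _ _ = contradiction eq (<⇒≢ (rank-mono-< Ku<Kv))
    ... | tri≈ _ Ku≡Kv _ = K-injective Ku≡Kv
    ... | tri> _ _ Kv<Ku = contradiction (sym eq) (<⇒≢ (rank-mono-< Kv<Ku))

    rankPermutation : Permutation′ n
    rankPermutation = fromInjection (λ v → fromℕ< (rank<n v))
                                    (rank-injective ∘ fromℕ<-injective _ _ (rank<n _) (rank<n _))

    index-rankPermutation : ∀ v → index rankPermutation v ≡ rank v
    index-rankPermutation v = toℕ-fromℕ< (rank<n v)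

*+-lex-≤ : ∀ {a a′ r r′} m → r′ < m → a * m + r ≤ a′ * m + r′ → a ≤ a′
*+-lex-≤ {a} {a′} {r} {r′} m r′<m ineq with a ≤? a′
... | yes a≤a′ = a≤a′
... | no  a≰a′ = contradiction ineq (<⇒≱ (begin-strict
  a′ * m + r′   <⟨ +-monoʳ-< (a′ * m) r′<m ⟩
  a′ * m + m    ≡⟨ +-comm (a′ * m) m ⟩
  suc a′ * m    ≤⟨ *-monoˡ-≤ m (≰⇒> a≰a′) ⟩
  a * m         ≤⟨ m≤m+n (a * m) r ⟩
  a * m + r     ∎))
  where open ≤-Reasoning

nondecreasingOrder : (h : Fin n → ℕ) →
                     Σ (Permutation′ n) λ σ → ∀ u v → index σ u ≤ index σ v → h u ≤ h v
nondecreasingOrder {n} h = σ , h-mono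
  where
  -- Ties of h are broken by the vertex number.
  K : Fin n → ℕ
  K v = h v * n + toℕ v

  K-≤ : ∀ {u v} → K u ≤ K v → h u ≤ h v
  K-≤ {v = v} = *+-lex-≤ n (toℕ<n v)

  K-injective : Injective _≡_ _≡_ K
  K-injective {u} {v} Ku≡Kv = toℕ-injective (+-cancelˡ-≡ (h v * n) _ _ (begin
    h v * n + toℕ u   ≡⟨ cong (λ x → x * n + toℕ u) hv≡hu ⟨
    K u               ≡⟨ Ku≡Kv ⟩
    K v               ∎))
    where
    open ≡-Reasoning
    hv≡hu : h u ≡ h v
    hv≡hu = ≤-antisym (K-≤ (≤-reflexive Ku≡Kv)) (K-≤ (≤-reflexive (sym Ku≡Kv)))

  σ : Permutation′ n
  σ = rankPermutation K K-injective

  h-mono : ∀ u v → index σ u ≤ index σ v → h u ≤ h v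
  h-mono u v iu≤iv = K-≤ (≮⇒≥ λ Kv<Ku → <⇒≱ (rank-mono-< K Kv<Ku) rank-u≤v)
    where
    rank-u≤v : rank K u ≤ rank K v
    rank-u≤v = subst₂ _≤_ (index-rankPermutation K K-injective u) (index-rankPermutation K K-injective v) iu≤iv

Loopless : Digraph n → Set
Loopless {n} A = (u : Fin n) → A u u ≡ false

removeArcs-loopless : {D : Digraph n} {S : Fin n → Fin n → Bool} → Loopless D → Loopless (removeArcs D S)
removeArcs-loopless loopless u rewrite loopless u = refl

removeArcs⁺ : {D : Digraph n} {S : Fin n → Fin n → Bool} {u v : Fin n} →
              D u v ≡ true → S u v ≡ false → removeArcs D S u v ≡ true
removeArcs⁺ Duv Suv rewrite Duv | Suv = refl

removeArcs⁻ : {D : Digraph n} {S : Fin n → Fin n → Bool} {u v : Fin n} →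
              removeArcs D S u v ≡ true → D u v ≡ true × S u v ≡ false
removeArcs⁻ {D = D} {S} {u} {v} e with D u v | S u v
removeArcs⁻ refl | true | false = refl , refl

module Walks (A : Digraph n) where

  open import Data.List.Membership.DecPropositional (_≟_ {n}) using (_∈?_)

  infix 4 _⟶_ _⟶*_

  _⟶_ : Fin n → Fin n → Set
  u ⟶ v = A u v ≡ true

  _⟶*_ : Fin n → Fin n → Set
  _⟶*_ = Star _⟶_

  loopless⇒irreflexive : Loopless A → ∀ {u} → ¬ (u ⟶ u)
  loopless⇒irreflexive loopless {u} u⟶u = contradiction (trans (sym u⟶u) (loopless u)) λ ()

  chain-++ : ∀ {x y z} zs ws → Chain A x zs y → Chain A y ws z → Chain A x (zs ++ y ∷ ws) z
  chain-++ []       ws x⟶y         y⇝z = x⟶y , y⇝z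
  chain-++ (_ ∷ zs) ws (x⟶z₁ , z₁⇝y) y⇝z = x⟶z₁ , chain-++ zs ws z₁⇝y y⇝z

  chain-split : ∀ {x y t} zs → Chain A x zs y → t ∈ zs → ∃₂ λ as bs → Chain A x as t × Chain A t bs y
  chain-split (_ ∷ zs) (x⟶t , t⇝y) (here refl) = [] , zs , x⟶t , t⇝y
  chain-split (z ∷ zs) (x⟶z , z⇝y) (there t∈zs) =
    let as , bs , z⇝t , t⇝y = chain-split zs z⇝y t∈zs in z ∷ as , bs , (x⟶z , z⇝t) , t⇝y

  SimplePath : Fin n → Fin n → Set
  SimplePath x y = ∃ λ ps → Chain A x ps y × Unique (x ∷ ps) × y ∉ x ∷ ps

  private
    suffix : ∀ {x y a} qs → Chain A a qs y → Unique (a ∷ qs) → y ∉ a ∷ qs → x ∈ a ∷ qs → SimplePath x y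
    suffix qs       a⇝y         unique       y∉ (here refl)  = qs , a⇝y , unique , y∉
    suffix (_ ∷ qs) (_ , q⇝y) (_ ∷ unique) y∉ (there x∈qs) = suffix qs q⇝y unique (y∉ ∘ there) x∈qs

  simplify : ∀ {x y} → x ⟶* y → x ≢ y → SimplePath x y
  simplify ε x≢x = contradiction refl x≢x
  simplify {x} {y} (_◅_ {j = z} x⟶z z⟶*y) x≢y with z ≟ y
  ... | yes refl = [] , x⟶z , [] ∷ [] , λ { (here y≡x) → x≢y (sym y≡x) }
  ... | no  z≢y with simplify z⟶*y z≢y
  ...   | ps , z⇝y , unique , y∉ with x ∈? z ∷ ps
  ...     | yes x∈ = suffix ps z⇝y unique y∉ x∈
  ...     | no  x∉ = z ∷ ps , (x⟶z , z⇝y) , ¬Any⇒All¬ _ x∉ ∷ unique ,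
                     λ { (here y≡x) → x≢y (sym y≡x) ; (there y∈) → y∉ y∈ }

  data Walk≤ : ℕ → Fin n → Fin n → Set where
    stay : ∀ {k x} → Walk≤ k x x
    step : ∀ {k x y z} → x ⟶ z → Walk≤ k z y → Walk≤ (suc k) x y

  walk≤? : ∀ k x y → Dec (Walk≤ k x y)
  walk≤? zero x y = map′ (λ { refl → stay }) (λ { stay → refl }) (x ≟ y)
  walk≤? (suc k) x y with x ≟ y
  ... | yes refl = yes stay
  ... | no  x≢y  = map′ (λ (z , x⟶z , z⇝y) → step x⟶z z⇝y)
                        (λ { stay → contradiction refl x≢y ; (step x⟶z z⇝y) → _ , x⟶z , z⇝y })
                        (any? λ z → (A x z Data.Bool.≟ true) ×-dec walk≤? k z y)

  walk≤⇒⟶* : ∀ {k x y} → Walk≤ k x y → x ⟶* y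
  walk≤⇒⟶* stay                = ε
  walk≤⇒⟶* (step x⟶z z⇝y) = x⟶z ◅ walk≤⇒⟶* z⇝y

  chain⇒walk≤ : ∀ {k x y} ps → Chain A x ps y → length ps < k → Walk≤ k x y
  chain⇒walk≤ []       x⟶y         (s≤s _) = step x⟶y stay
  chain⇒walk≤ (_ ∷ ps) (x⟶p , p⇝y) (s≤s l) = step x⟶p (chain⇒walk≤ ps p⇝y l)

  reachable? : ∀ x y → Dec (x ⟶* y)
  reachable? x y with x ≟ y
  ... | yes refl = yes ε
  ... | no  x≢y  = map′ walk≤⇒⟶* shortcut (walk≤? n x y)
    where
    -- A simple path has fewer than n arcs.
    shortcut : x ⟶* y → Walk≤ n x y
    shortcut x⟶*y =
      let ps , x⇝y , unique , _ = simplify x⟶*y x≢y in chain⇒walk≤ ps x⇝y (unique⇒length≤ unique)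

  OnCycle : Fin n → Set
  OnCycle x = ∃ λ w → x ⟶ w × w ⟶* x

  closeCycle : ∀ {x y} → x ⟶* y → y ⟶ x → OnCycle x
  closeCycle ε                y⟶x = _ , y⟶x , ε
  closeCycle (x⟶z ◅ z⟶*y) y⟶x = _ , x⟶z , z⟶*y ◅◅ (y⟶x ◅ ε)

  onCycle⇒cycle : Loopless A → ∀ {x} → OnCycle x → ∃ λ vs → IsCycle A x vs
  onCycle⇒cycle loopless {x} (w , x⟶w , w⟶*x) =
    let ps , w⇝x , unique , x∉ = simplify w⟶*x w≢x in
    w ∷ ps , (¬Any⇒All¬ _ x∉ ∷ unique) , s≤s z≤n , x⟶w , w⇝x
    where
    w≢x : w ≢ x
    w≢x refl = loopless⇒irreflexive loopless x⟶w

  TCycle⇒closedWalk : ∀ {T v vs} → IsTCycle A T v vs → ∃ λ t → t Subset.∈ T × ∃ λ ws → Chain A t ws t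
  TCycle⇒closedWalk {v = v} {vs} ((_ , _ , v⇝v) , someTerminal) with find someTerminal
  ... | t , here refl  , t∈T = t , t∈T , vs , v⇝v
  ... | t , there t∈vs , t∈T =
    let as , bs , v⇝t , t⇝v = chain-split vs v⇝v t∈vs in t , t∈T , bs ++ v ∷ as , chain-++ bs as t⇝v v⇝t

T-∧⁺ : ∀ {a b} → T a → T b → T (a ∧ b)
T-∧⁺ a b = Equivalence.from T-∧ (a , b)

BackwardAbove : Permutation′ n → Fin n → Fin n → Fin n → Set
BackwardAbove σ u v t = index σ v < index σ u × index σ v ≤ index σ t × index σ t ≤ index σ u

module _ (D : Digraph n) (T : Subset n) (σ : Permutation′ n) {u v : Fin n} where

  affected⇒ : affected D T σ u v ≡ true → D u v ≡ true × ∃ λ t → t Subset.∈ T × BackwardAbove σ u v t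
  affected⇒ isAffected
    with Duv , rest       ← Equivalence.to (T-∧ {D u v}) (Equivalence.from T-≡ isAffected)
    with v<u , someT      ← Equivalence.to (T-∧ {⌊ pos σ v Fin.<? pos σ u ⌋}) rest
    with t , t∈T∧spanned ← satisfied (any⁻ _ (allFin n) someT)
    with t∈T , spanned    ← Equivalence.to (T-∧ {T ‼ t}) t∈T∧spanned
    with v≤t , t≤u        ← Equivalence.to (T-∧ {⌊ pos σ v Fin.≤? pos σ t ⌋}) spanned
    = Equivalence.to T-≡ Duv , t , lookup⇒[]= t T (Equivalence.to T-≡ t∈T) ,
      toWitness v<u , toWitness v≤t , toWitness t≤u

  affected⇐ : ∀ {t} → D u v ≡ true → t Subset.∈ T → BackwardAbove σ u v t → affected D T σ u v ≡ true
  affected⇐ {t} Duv t∈T (v<u , v≤t , t≤u) =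
    Equivalence.to T-≡ (T-∧⁺ (Equivalence.from T-≡ Duv)
      (T-∧⁺ (fromWitness {a? = pos σ v Fin.<? pos σ u} v<u)
        (any⁺ _ (lose (∈-allFin t)
          (T-∧⁺ (Equivalence.from T-≡ ([]=⇒lookup t∈T))
            (T-∧⁺ (fromWitness {a? = pos σ v Fin.≤? pos σ t} v≤t)
                  (fromWitness {a? = pos σ t Fin.≤? pos σ u} t≤u)))))))

module _ (A : Digraph n) (σ : Permutation′ n) (t : Fin n) where
  open Walks A

  BackwardArcAbove : Set
  BackwardArcAbove = ∃₂ λ a b → a ⟶ b × BackwardAbove σ a b t

  chain⇒backwardArcAbove : ∀ {x y} zs → Chain A x zs y →
                           index σ y ≤ index σ t → index σ t ≤ index σ x → index σ y < index σ x →
                           BackwardArcAbove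
  chain⇒backwardArcAbove []       x⟶y         y≤t t≤x y<x = _ , _ , x⟶y , y<x , y≤t , t≤x
  chain⇒backwardArcAbove {x} (z ∷ zs) (x⟶z , z⇝y) y≤t t≤x y<x
    with index σ z ≤? index σ t | index σ z <? index σ x
  ... | no  z≰t | _       =
    chain⇒backwardArcAbove zs z⇝y y≤t (<⇒≤ (≰⇒> z≰t)) (≤-<-trans y≤t (≰⇒> z≰t))
  ... | yes z≤t | yes z<x = _ , _ , x⟶z , z<x , z≤t , t≤x
  ... | yes z≤t | no  z≮x =
    chain⇒backwardArcAbove zs z⇝y y≤t (≤-trans t≤x (≮⇒≥ z≮x)) (<-≤-trans y<x (≮⇒≥ z≮x))

  closedWalk⇒backwardArcAbove : Loopless A → ∀ ws → Chain A t ws t → BackwardArcAbove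
  closedWalk⇒backwardArcAbove loopless []       t⟶t = contradiction t⟶t (loopless⇒irreflexive loopless)
  closedWalk⇒backwardArcAbove loopless (z ∷ zs) (t⟶z , z⇝t) with <-cmp (index σ z) (index σ t)
  ... | tri< z<t _ _ = _ , _ , t⟶z , z<t , <⇒≤ z<t , ≤-refl
  ... | tri≈ _ z≡t _ =
    contradiction (subst (t ⟶_) (index-injective σ z≡t) t⟶z) (loopless⇒irreflexive loopless)
  ... | tri> _ _ t<z = chain⇒backwardArcAbove zs z⇝t ≤-refl (<⇒≤ t<z) t<z

affected-isTFAS : {D : Digraph n} {T : Subset n} → Loopless D → (σ : Permutation′ n) →
                  IsTFAS D T (affected D T σ)
affected-isTFAS {D = D} {T} loopless σ = (λ u v → proj₁ ∘ affected⇒ D T σ) , noTCycle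
  where
  open Walks (removeArcs D (affected D T σ))

  noTCycle : ∀ v vs → ¬ IsTCycle (removeArcs D (affected D T σ)) T v vs
  noTCycle v vs tCycle =
    let t , t∈T , ws , t⇝t = TCycle⇒closedWalk tCycle
        a , b , a⟶b , above =
          closedWalk⇒backwardArcAbove _ σ t (removeArcs-loopless {D = D} {affected D T σ} loopless) ws t⇝t
        Dab , notAffected = removeArcs⁻ {D = D} {affected D T σ} a⟶b
    in contradiction (trans (sym (affected⇐ D T σ Dab t∈T above)) notAffected) λ ()

module Levels (A : Digraph n) (T : Subset n) where
  open Walks A

  ancestorCount : Fin n → ℕ
  ancestorCount v = countTrue (λ w → ⌊ reachable? w v ⌋) (allFin n)

  private
    reaches-trans : ∀ {u v} → u ⟶* v → ∀ {w} → True (reachable? w u) → True (reachable? w v)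
    reaches-trans u⟶*v w⟶*u = fromWitness (toWitness w⟶*u ◅◅ u⟶*v)

  ancestorCount-mono-≤ : ∀ {u v} → u ⟶* v → ancestorCount u ≤ ancestorCount v
  ancestorCount-mono-≤ u⟶*v = countTrue-mono-≤ (reaches-trans u⟶*v) (allFin n)

  ancestorCount-mono-< : ∀ {u v} → u ⟶* v → ¬ (v ⟶* u) → ancestorCount u < ancestorCount v
  ancestorCount-mono-< {v = v} u⟶*v v↛u =
    countTrue-mono-< (reaches-trans u⟶*v) (∈-allFin v) (v↛u ∘ toWitness) (fromWitness ε)

  level : Fin n → ℕ
  level v = if T ‼ v then 2 * ancestorCount v else suc (2 * ancestorCount v)

  level-terminal : ∀ {v} → T ‼ v ≡ true → level v ≡ 2 * ancestorCount v
  level-terminal v∈T = cong (λ b → if b then _ else _) v∈T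

  level-nonterminal : ∀ {v} → T ‼ v ≡ false → level v ≡ suc (2 * ancestorCount v)
  level-nonterminal v∉T = cong (λ b → if b then _ else _) v∉T

  level-≥ : ∀ v → 2 * ancestorCount v ≤ level v
  level-≥ v with T ‼ v
  ... | true  = ≤-refl
  ... | false = n≤1+n _

  level-≤ : ∀ v → level v ≤ suc (2 * ancestorCount v)
  level-≤ v with T ‼ v
  ... | true  = n≤1+n _
  ... | false = ≤-refl

  levelOrder : Permutation′ n
  levelOrder = proj₁ (nondecreasingOrder level)

  level-mono : ∀ {x y} → index levelOrder x ≤ index levelOrder y → level x ≤ level y
  level-mono = proj₂ (nondecreasingOrder level) _ _

  level-≤⇒reachable : ∀ {u v} → u ⟶ v → level v ≤ level u → v ⟶* u
  level-≤⇒reachable {u} {v} u⟶v lv≤lu with reachable? v u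
  ... | yes v⟶*u = v⟶*u
  ... | no  v↛u  = contradiction lv≤lu (<⇒≱ (begin-strict
    level u                      ≤⟨ level-≤ u ⟩
    suc (2 * ancestorCount u)    <⟨ n<1+n _ ⟩
    2 + 2 * ancestorCount u      ≡⟨ *-suc 2 (ancestorCount u) ⟨
    2 * suc (ancestorCount u)    ≤⟨ *-monoʳ-≤ 2 (ancestorCount-mono-< (u⟶v ◅ ε) v↛u) ⟩
    2 * ancestorCount v          ≤⟨ level-≥ v ⟩
    level v                      ∎))
    where open ≤-Reasoning

  module _ (loopless : Loopless A) (noTCycle : ∀ v vs → ¬ IsTCycle A T v vs) where

    onCycle⇒nonterminal : ∀ {v} → OnCycle v → T ‼ v ≡ false
    onCycle⇒nonterminal {v} onCycle with T ‼ v in v∈T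
    ... | false = refl
    ... | true  = let vs , cycle = onCycle⇒cycle loopless onCycle in
                  contradiction (cycle , here (lookup⇒[]= v T v∈T)) (noTCycle v vs)

    terminal-not-between-levels : ∀ {u v t} → u ⟶ v → v ⟶* u → T ‼ t ≡ true →
                                  level v ≤ level t → level t ≤ level u → ⊥
    terminal-not-between-levels {u} {v} {t} u⟶v v⟶*u t∈T lv≤lt lt≤lu =
      even≢odd (ancestorCount t) (ancestorCount v) (begin-equality
      2 * ancestorCount t        ≡⟨ level-terminal t∈T ⟨
      level t                    ≡⟨ ≤-antisym (≤-trans lt≤lu lu≤lv) lv≤lt ⟩
      level v                    ≡⟨ level-nonterminal (onCycle⇒nonterminal (closeCycle v⟶*u u⟶v)) ⟩
      suc (2 * ancestorCount v)  ∎)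
      where
      open ≤-Reasoning
      lu≤lv : level u ≤ level v
      lu≤lv = begin
        level u                    ≡⟨ level-nonterminal (onCycle⇒nonterminal (v , u⟶v , v⟶*u)) ⟩
        suc (2 * ancestorCount u)  ≤⟨ s≤s (*-monoʳ-≤ 2 (ancestorCount-mono-≤ (u⟶v ◅ ε))) ⟩
        suc (2 * ancestorCount v)  ≡⟨ level-nonterminal (onCycle⇒nonterminal (closeCycle v⟶*u u⟶v)) ⟨
        level v                    ∎

    backwardArc-not-above-terminal : ∀ {u v t} → u ⟶ v → t Subset.∈ T → ¬ BackwardAbove levelOrder u v t
    backwardArc-not-above-terminal u⟶v t∈T (v<u , v≤t , t≤u) =
      terminal-not-between-levels u⟶v (level-≤⇒reachable u⟶v (level-mono (<⇒≤ v<u))) ([]=⇒lookup t∈T)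
                                  (level-mono v≤t) (level-mono t≤u)

levelOrder-affected⊆ : {D : Digraph n} {T : Subset n} {S : Fin n → Fin n → Bool} → Loopless D → IsTFAS D T S →
                       ∀ u v → affected D T (Levels.levelOrder (removeArcs D S) T) u v ≡ true → S u v ≡ true
levelOrder-affected⊆ {D = D} {T} {S} loopless (_ , noTCycle) u v isAffected = ¬-not λ uv∉S →
  let Duv , t , t∈T , above = affected⇒ D T levelOrder isAffected in
  backwardArc-not-above-terminal (removeArcs-loopless {D = D} {S} loopless) noTCycle
    (removeArcs⁺ {D = D} {S} Duv uv∉S) t∈T above
  where open Levels (removeArcs D S) T

proposition1 : (n : ℕ) (D : Digraph n) → IsTournament D → (T : Subset n) (k : ℕ) →
    (Σ (Fin n → Fin n → Bool) (λ S → IsTFAS D T S × countPairs S ≤ k))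
      ⇔ Σ (Permutation′ n) (λ σ → cost D T σ ≤ k)
proposition1 n D (loopless , _) T k = mk⇔
  (λ (S , isTFAS , |S|≤k) → Levels.levelOrder (removeArcs D S) T ,
     ≤-trans (countPairs-mono (levelOrder-affected⊆ loopless isTFAS)) |S|≤k)
  (λ (σ , cost≤k) → affected D T σ , affected-isTFAS loopless σ , cost≤k)
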